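{- Let $G=G([n],E)$ be a connected comparability graph having at least one proper non-trivial connected module. Then $G$ has more than two transitive orientations.
   Context: $N(X)=\{j\notin X:\exists i\in X,\{i,j\}\in E\}$; a module is $A\subseteq[n]$ with $N(i)\setminus A=N(j)\setminus A=N(A)$ for all $i,j\in A$; proper means $A\ne[n]$, non-trivial $|A|>1$, connected $G[A]$ connected. A transitive orientation is an acyclic orientation of all edges whose reachability partial order has comparability graph equal to $G$. -}

module Defs where

open import Data.Nat using (ℕ; _>_)
open import Data.Bool using (Bool; T)
open import Data.Fin using (Fin)
open import Data.Fin.Subset using (Subset; _∈_; _∉_; ⁅_⁆; ⊤; ∣_∣)
open import Data.Product using (Σ; ∃; _×_)
open import Data.Sum using (_⊎_)
open import Data.Empty using (⊥)
open import Relation.Nullary using (¬_)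
open import Relation.Binary.PropositionalEquality using (_≡_; _≢_)
open import Relation.Binary.Construct.Closure.ReflexiveTransitive using (Star)
open import Relation.Binary.Construct.Closure.Transitive using (TransClosure)
open import Function.Bundles using (_⇔_)

record Graph (n : ℕ) : Set where
  field
    adj   : Fin n → Fin n → Bool
    sym   : ∀ i j → adj i j ≡ adj j i
    irrefl : ∀ i → adj i i ≡ Data.Bool.false

open Graph public

Edge : ∀ {n} → Graph n → Fin n → Fin n → Set
Edge G i j = T (adj G i j)

Connected : ∀ {n} → Graph n → Set
Connected {n} G = ∀ (i j : Fin n) → Star (Edge G) i j

Nbhd : ∀ {n} → Graph n → Subset n → Fin n → Set
Nbhd G X j = j ∉ X × ∃ λ i → i ∈ X × Edge G i j

-- A is a module: for all i,j ∈ A, N(i) \ A = N(j) \ A = N(A)  (as sets)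
IsModule : ∀ {n} → Graph n → Subset n → Set
IsModule {n} G A = ∀ (i j : Fin n) → i ∈ A → j ∈ A → ∀ (k : Fin n) →
  ((Nbhd G ⁅ i ⁆ k × k ∉ A) ⇔ (Nbhd G ⁅ j ⁆ k × k ∉ A)) ×
  ((Nbhd G ⁅ j ⁆ k × k ∉ A) ⇔ Nbhd G A k)

Proper : ∀ {n} → Subset n → Set
Proper A = A ≢ ⊤

NonTrivial : ∀ {n} → Subset n → Set
NonTrivial A = ∣ A ∣ > 1

InducedEdge : ∀ {n} → Graph n → Subset n → Fin n → Fin n → Set
InducedEdge G A i j = i ∈ A × j ∈ A × Edge G i j

ConnectedIn : ∀ {n} → Graph n → Subset n → Set
ConnectedIn {n} G A = ∀ (i j : Fin n) → i ∈ A → j ∈ A → Star (InducedEdge G A) i j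

Orientation : ℕ → Set
Orientation n = Fin n → Fin n → Bool

Arc : ∀ {n} → Orientation n → Fin n → Fin n → Set
Arc O i j = T (O i j)

record IsTransitiveOrientation {n} (G : Graph n) (O : Orientation n) : Set where
  field
    arcs-edges : ∀ i j → Arc O i j → Edge G i j
    orients    : ∀ i j → Edge G i j →
                 (Arc O i j × ¬ Arc O j i) ⊎ (Arc O j i × ¬ Arc O i j)
    acyclic    : ∀ i → ¬ TransClosure (Arc O) i i
    comparability : ∀ i j →
      Edge G i j ⇔ (i ≢ j × (Star (Arc O) i j ⊎ Star (Arc O) j i))

IsComparabilityGraph : ∀ {n} → Graph n → Set
IsComparabilityGraph G = ∃ λ O → IsTransitiveOrientation G O

MoreThanTwoTransitiveOrientations : ∀ {n} → Graph n → Set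
MoreThanTwoTransitiveOrientations {n} G =
  Σ (Orientation n) λ O₁ → Σ (Orientation n) λ O₂ → Σ (Orientation n) λ O₃ →
    IsTransitiveOrientation G O₁ × IsTransitiveOrientation G O₂ ×
    IsTransitiveOrientation G O₃ ×
    O₁ ≢ O₂ × O₁ ≢ O₃ × O₂ ≢ O₃

-- Let O be a transitive orientation of G and A a module. Because every vertex outside A
-- is adjacent to all of A or to none of it, one may keep O outside A, orient every edge
-- between A and the outside as O orients the corresponding edge at one fixed vertex
-- a₀ ∈ A, and orient the inside of A by any transitive orientation of G[A]; the result
-- is again transitive. Taking O or its reverse inside A, together with the reverse of
-- the first choice, gives three orientations: the first two differ on an edge of G[A]
-- (which exists since G[A] is connected and has two vertices), the first and third on
-- the same edge, and the last two on an edge leaving A (which exists since G is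
-- connected and A is proper).
module Submission where

open import Defs
open import Data.Nat using (ℕ; _>_; s≤s)
open import Data.Nat.Properties using (>⇒≢)
open import Data.Bool using (T)
open import Data.Fin using (Fin; zero; suc; _≟_)
open import Data.Fin.Properties using (¬∀⟶∃¬; suc-injective)
open import Data.Fin.Subset using (Subset; _∈_; _∉_; ⊤; ∣_∣; Nonempty; inside; outside)
open import Data.Fin.Subset.Properties
  using (_∈?_; nonempty?; Empty-unique; ∣⊥∣≡0; ⊆-antisym; ⊆⊤; x∈⁅x⁆; x∈⁅y⁆⇒x≡y)
open import Data.Vec using (_∷_; here; there)
open import Data.Product using (∃; ∃₂; _×_; _,_; proj₁)
open import Data.Sum using (_⊎_; inj₁; inj₂)
open import Data.Empty using (⊥-elim)
open import Relation.Nullary using (¬_; yes; no; contradiction)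
open import Relation.Unary using (Pred; Decidable)
open import Relation.Binary using (Rel)
open import Relation.Binary.PropositionalEquality
  using (_≡_; _≢_; refl; trans; cong; subst; module ≡-Reasoning)
  renaming (sym to ≡-sym)
open import Relation.Binary.Construct.Closure.ReflexiveTransitive using (Star; ε; _◅_)
open import Relation.Binary.Construct.Closure.Transitive using (TransClosure; [_]; _∷_)
open import Function.Bundles using (mk⇔; Equivalence)

∣p∣>0⇒Nonempty : ∀ {n} (p : Subset n) → ∣ p ∣ > 0 → Nonempty p
∣p∣>0⇒Nonempty {n} p ∣p∣>0 with nonempty? p
... | yes ne = ne
... | no ¬ne = contradiction (trans (cong ∣_∣ (Empty-unique ¬ne)) (∣⊥∣≡0 n)) (>⇒≢ ∣p∣>0)

∣p∣>1⇒distinct-members : ∀ {n} (p : Subset n) → ∣ p ∣ > 1 →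
                         ∃₂ λ x y → x ∈ p × y ∈ p × x ≢ y
∣p∣>1⇒distinct-members (inside ∷ p) (s≤s ∣p∣>0) with ∣p∣>0⇒Nonempty p ∣p∣>0
... | x , x∈p = zero , suc x , here , there x∈p , λ ()
∣p∣>1⇒distinct-members (outside ∷ p) ∣p∣>1 with ∣p∣>1⇒distinct-members p ∣p∣>1
... | x , y , x∈p , y∈p , x≢y =
  suc x , suc y , there x∈p , there y∈p , λ eq → x≢y (suc-injective eq)

p≢⊤⇒∃∉ : ∀ {n} {p : Subset n} → p ≢ ⊤ → ∃ λ x → x ∉ p
p≢⊤⇒∃∉ {n} {p} p≢⊤ =
  ¬∀⟶∃¬ n (_∈ p) (_∈? p) (λ ∀∈ → p≢⊤ (⊆-antisym ⊆⊤ (λ {x} _ → ∀∈ x)))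

module _ {a ℓ} {X : Set a} {R : Rel X ℓ} where

  Star-≢⇒step : ∀ {x y} → Star R x y → x ≢ y → ∃₂ R
  Star-≢⇒step ε         x≢x = ⊥-elim (x≢x refl)
  Star-≢⇒step (r ◅ _) _     = _ , _ , r

  Star-crossing : ∀ {p} {P : Pred X p} → Decidable P → ∀ {x y} → Star R x y →
                  P x → ¬ P y → ∃₂ λ u v → P u × ¬ P v × R u v
  Star-crossing P? ε Px ¬Py = contradiction Px ¬Py
  Star-crossing P? (_◅_ {j = z} r rs) Px ¬Py with P? z
  ... | yes Pz = Star-crossing P? rs Pz ¬Py
  ... | no ¬Pz = _ , z , Px , ¬Pz , r

module _ {n : ℕ} (G : Graph n) where

  Edge-irrefl : ∀ i → ¬ Edge G i i
  Edge-irrefl i e rewrite irrefl G i = e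

  Edge-sym : ∀ {i j} → Edge G i j → Edge G j i
  Edge-sym {i} {j} e rewrite Graph.sym G i j = e

  IsModule⇒edge-transfer : ∀ {A} → IsModule G A →
                           ∀ {i i′ k} → i ∈ A → i′ ∈ A → k ∉ A → Edge G i k → Edge G i′ k
  IsModule⇒edge-transfer {A} isModule {i} {i′} {k} i∈A i′∈A k∉A e
    with Equivalence.to (proj₁ (isModule i i′ i∈A i′∈A k)) (k∈N[i] , k∉A)
    where
      k∈N[i] : Nbhd G _ k
      k∈N[i] = (λ k∈⁅i⁆ → k∉A (subst (_∈ A) (≡-sym (x∈⁅y⁆⇒x≡y i k∈⁅i⁆)) i∈A)) ,
               i , x∈⁅x⁆ i , e
  ... | (_ , j , j∈⁅i′⁆ , e′) , _ = subst (λ z → Edge G z k) (x∈⁅y⁆⇒x≡y i′ j∈⁅i′⁆) e′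

  -- The textbook definition, equivalent to IsTransitiveOrientation but local (a condition
  -- on vertex triples), which is what makes gluing orientations tractable.
  record IsTransitiveOrientation′ (O : Orientation n) : Set where
    field
      arcs-edges : ∀ i j → Arc O i j → Edge G i j
      orients    : ∀ i j → Edge G i j →
                   (Arc O i j × ¬ Arc O j i) ⊎ (Arc O j i × ¬ Arc O i j)
      trans-arc  : ∀ {i j k} → Arc O i j → Arc O j k → Arc O i k

    arc-irrefl : ∀ {i} → ¬ Arc O i i
    arc-irrefl {i} a = Edge-irrefl i (arcs-edges i i a)

    edge⇒arc : ∀ {i j} → Edge G i j → Arc O i j ⊎ Arc O j i
    edge⇒arc {i} {j} e with orients i j e
    ... | inj₁ (a , _) = inj₁ a
    ... | inj₂ (a , _) = inj₂ a

    edge⇒O-ij≢O-ji : ∀ {i j} → Edge G i j → O i j ≢ O j i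
    edge⇒O-ij≢O-ji {i} {j} e eq with orients i j e
    ... | inj₁ (a , ¬a′) = ¬a′ (subst T eq a)
    ... | inj₂ (a , ¬a′) = ¬a′ (subst T (≡-sym eq) a)

    TransClosure⇒arc : ∀ {i j} → TransClosure (Arc O) i j → Arc O i j
    TransClosure⇒arc [ a ]    = a
    TransClosure⇒arc (a ∷ as) = trans-arc a (TransClosure⇒arc as)

    Star-≢⇒arc : ∀ {i j} → Star (Arc O) i j → i ≢ j → Arc O i j
    Star-≢⇒arc ε i≢i = ⊥-elim (i≢i refl)
    Star-≢⇒arc {j = j} (_◅_ {j = k} a as) _ with k ≟ j
    ... | yes refl = a
    ... | no k≢j   = trans-arc a (Star-≢⇒arc as k≢j)

  open IsTransitiveOrientation′

  IsTransitiveOrientation′⇒IsTransitiveOrientation :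
    ∀ {O} → IsTransitiveOrientation′ O → IsTransitiveOrientation G O
  IsTransitiveOrientation′⇒IsTransitiveOrientation {O} t = record
    { arcs-edges    = arcs-edges t
    ; orients       = orients t
    ; acyclic       = λ i as → arc-irrefl t (TransClosure⇒arc t as)
    ; comparability = λ i j → mk⇔
        (λ e → (λ { refl → Edge-irrefl i e }) , arc⇒Star (edge⇒arc t e))
        (λ { (i≢j , inj₁ as) → arcs-edges t i j (Star-≢⇒arc t as i≢j)
           ; (i≢j , inj₂ as) →
               Edge-sym (arcs-edges t j i (Star-≢⇒arc t as λ j≡i → i≢j (≡-sym j≡i))) })
    }
    where
      arc⇒Star : ∀ {i j} → Arc O i j ⊎ Arc O j i → Star (Arc O) i j ⊎ Star (Arc O) j i
      arc⇒Star (inj₁ a) = inj₁ (a ◅ ε)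
      arc⇒Star (inj₂ a) = inj₂ (a ◅ ε)

  IsTransitiveOrientation⇒IsTransitiveOrientation′ :
    ∀ {O} → IsTransitiveOrientation G O → IsTransitiveOrientation′ O
  IsTransitiveOrientation⇒IsTransitiveOrientation′ {O} t = record
    { arcs-edges = arcs-edges′ ; orients = orients′ ; trans-arc = trans-arc′ }
    where
      open IsTransitiveOrientation t
        renaming (arcs-edges to arcs-edges′; orients to orients′)
      trans-arc′ : ∀ {i j k} → Arc O i j → Arc O j k → Arc O i k
      trans-arc′ {i} {j} {k} a b with i ≟ k
      ... | yes refl = ⊥-elim (acyclic i (a ∷ [ b ]))
      ... | no i≢k with orients′ i k (Equivalence.from (comparability i k)
                                        (i≢k , inj₁ (a ◅ b ◅ ε)))
      ...   | inj₁ (c , _) = c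
      ...   | inj₂ (c , _) = ⊥-elim (acyclic i (a ∷ b ∷ [ c ]))

  reverse : Orientation n → Orientation n
  reverse O i j = O j i

  reverse-isTransitiveOrientation′ :
    ∀ {O} → IsTransitiveOrientation′ O → IsTransitiveOrientation′ (reverse O)
  reverse-isTransitiveOrientation′ t = record
    { arcs-edges = λ i j a → Edge-sym (arcs-edges t j i a)
    ; orients    = λ i j e → orients t j i (Edge-sym e)
    ; trans-arc  = λ a b → trans-arc t b a
    }

substitute : ∀ {n} → Subset n → Fin n → Orientation n → Orientation n → Orientation n
substitute A a₀ B Q i j with i ∈? A | j ∈? A
... | yes _ | yes _ = Q i j
... | yes _ | no _  = B a₀ j
... | no _  | yes _ = B i a₀
... | no _  | no _  = B i j

module Substitution {n : ℕ} (G : Graph n) {A : Subset n} (isModule : IsModule G A)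
                    {a₀ : Fin n} (a₀∈A : a₀ ∈ A) where

  private
    transfer = IsModule⇒edge-transfer G isModule

  substitute-isTransitiveOrientation′ :
    ∀ {B Q} → IsTransitiveOrientation′ G B → IsTransitiveOrientation′ G Q →
    IsTransitiveOrientation′ G (substitute A a₀ B Q)
  substitute-isTransitiveOrientation′ {B} {Q} tB tQ = record
    { arcs-edges = arcs-edges′ ; orients = orients′
    ; trans-arc = λ {i} {j} {k} → trans-arc′ {i} {j} {k} }
    where
      module B = IsTransitiveOrientation′ tB
      module Q = IsTransitiveOrientation′ tQ
      S = substitute A a₀ B Q

      arcs-edges′ : ∀ i j → Arc S i j → Edge G i j
      arcs-edges′ i j a with i ∈? A | j ∈? A
      ... | yes _   | yes _   = Q.arcs-edges i j a
      ... | yes i∈A | no j∉A  = transfer a₀∈A i∈A j∉A (B.arcs-edges a₀ j a)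
      ... | no i∉A  | yes j∈A =
        Edge-sym G (transfer a₀∈A j∈A i∉A (Edge-sym G (B.arcs-edges i a₀ a)))
      ... | no _    | no _    = B.arcs-edges i j a

      orients′ : ∀ i j → Edge G i j → (Arc S i j × ¬ Arc S j i) ⊎ (Arc S j i × ¬ Arc S i j)
      orients′ i j e with i ∈? A | j ∈? A
      ... | yes _   | yes _   = Q.orients i j e
      ... | yes i∈A | no j∉A  = B.orients a₀ j (transfer i∈A a₀∈A j∉A e)
      ... | no i∉A  | yes j∈A =
        B.orients i a₀ (Edge-sym G (transfer j∈A a₀∈A i∉A (Edge-sym G e)))
      ... | no _    | no _    = B.orients i j e

      -- In the mixed cases every vertex of A acts as a₀, so each case is transitivity of
      -- B or Q, except i, k ∈ A, j ∉ A, which would be a 2-cycle a₀ → j → a₀ of B.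
      trans-arc′ : ∀ {i j k} → Arc S i j → Arc S j k → Arc S i k
      trans-arc′ {i} {j} {k} a b with i ∈? A | j ∈? A | k ∈? A
      ... | yes _ | yes _ | yes _ = Q.trans-arc a b
      ... | yes _ | yes _ | no _  = b
      ... | yes _ | no _  | yes _ = ⊥-elim (B.arc-irrefl (B.trans-arc a b))
      ... | yes _ | no _  | no _  = B.trans-arc a b
      ... | no _  | yes _ | yes _ = a
      ... | no _  | yes _ | no _  = B.trans-arc a b
      ... | no _  | no _  | yes _ = B.trans-arc a b
      ... | no _  | no _  | no _  = B.trans-arc a b

substitute-inside : ∀ {n} {A : Subset n} {a₀ B Q i j} → i ∈ A → j ∈ A →
                    substitute A a₀ B Q i j ≡ Q i j
substitute-inside {A = A} {i = i} {j} i∈A j∈A with i ∈? A | j ∈? A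
... | yes _  | yes _  = refl
... | no i∉A | _      = contradiction i∈A i∉A
... | yes _  | no j∉A = contradiction j∈A j∉A

substitute-leaving : ∀ {n} {A : Subset n} {a₀ B Q i j} → i ∈ A → j ∉ A →
                     substitute A a₀ B Q i j ≡ B a₀ j
substitute-leaving {A = A} {i = i} {j} i∈A j∉A with i ∈? A | j ∈? A
... | yes _  | no _    = refl
... | no i∉A | _       = contradiction i∈A i∉A
... | yes _  | yes j∈A = contradiction j∈A j∉A

substitute-entering : ∀ {n} {A : Subset n} {a₀ B Q i j} → i ∉ A → j ∈ A →
                      substitute A a₀ B Q i j ≡ B i a₀
substitute-entering {A = A} {i = i} {j} i∉A j∈A with i ∈? A | j ∈? A
... | no _    | yes _  = refl
... | yes i∈A | _      = contradiction i∈A i∉A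
... | no _    | no j∉A = contradiction j∈A j∉A

≢-at : ∀ {n} {O O′ : Orientation n} i j → O i j ≢ O′ i j → O ≢ O′
≢-at i j ne eq = ne (cong (λ O → O i j) eq)

module _ {n : ℕ} (G : Graph n) {O : Orientation n} (tO : IsTransitiveOrientation′ G O)
         {A : Subset n} (isModule : IsModule G A) where

  open Substitution G isModule
  open ≡-Reasoning

  module-with-inner-and-outgoing-edge⇒MoreThanTwoTransitiveOrientations :
    ∀ {a b x y} → a ∈ A → b ∈ A → Edge G a b → x ∈ A → y ∉ A → Edge G x y →
    MoreThanTwoTransitiveOrientations G
  module-with-inner-and-outgoing-edge⇒MoreThanTwoTransitiveOrientations
    {a} {b} {x} {y} a∈A b∈A ab x∈A y∉A xy =
    O₁ , O₂ , O₃ , to-IsTO t₁ , to-IsTO t₂ , to-IsTO t₃ ,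
    ≢-at a b (λ eq → edge⇒O-ij≢O-ji tO ab (begin
      O a b  ≡⟨ substitute-inside a∈A b∈A ⟨
      O₁ a b ≡⟨ eq ⟩
      O₂ a b ≡⟨ substitute-inside a∈A b∈A ⟩
      O b a  ∎)) ,
    ≢-at a b (λ eq → edge⇒O-ij≢O-ji tO ab (begin
      O a b  ≡⟨ substitute-inside a∈A b∈A ⟨
      O₁ a b ≡⟨ eq ⟩
      O₁ b a ≡⟨ substitute-inside b∈A a∈A ⟩
      O b a  ∎)) ,
    ≢-at x y (λ eq → edge⇒O-ij≢O-ji tO (IsModule⇒edge-transfer G isModule x∈A a∈A y∉A xy)
      (begin
      O a y  ≡⟨ substitute-leaving x∈A y∉A ⟨
      O₂ x y ≡⟨ eq ⟩
      O₁ y x ≡⟨ substitute-entering y∉A x∈A ⟩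
      O y a  ∎))
    where
      open IsTransitiveOrientation′
      to-IsTO = IsTransitiveOrientation′⇒IsTransitiveOrientation G
      O₁ = substitute A a O O
      O₂ = substitute A a O (reverse G O)
      O₃ = reverse G O₁
      t₁ = substitute-isTransitiveOrientation′ a∈A tO tO
      t₂ = substitute-isTransitiveOrientation′ a∈A tO (reverse-isTransitiveOrientation′ G tO)
      t₃ = reverse-isTransitiveOrientation′ G t₁

corollary3p15 : ∀ (n : ℕ) (G : Graph n) → Connected G → IsComparabilityGraph G →
    (∃ λ (A : Subset n) → IsModule G A × Proper A × NonTrivial A × ConnectedIn G A) →
    MoreThanTwoTransitiveOrientations G
corollary3p15 n G connected (O , isTO) (A , isModule , proper , nonTrivial , connectedA)
  with ∣p∣>1⇒distinct-members A nonTrivial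
... | a₀ , a₁ , a₀∈A , a₁∈A , a₀≢a₁
  with Star-≢⇒step (connectedA a₀ a₁ a₀∈A a₁∈A) a₀≢a₁
     | p≢⊤⇒∃∉ proper
... | a , b , a∈A , b∈A , ab | z , z∉A
  with Star-crossing (_∈? A) (connected a₀ z) a₀∈A z∉A
... | x , y , x∈A , y∉A , xy =
  module-with-inner-and-outgoing-edge⇒MoreThanTwoTransitiveOrientations
    G (IsTransitiveOrientation⇒IsTransitiveOrientation′ G isTO) isModule
    a∈A b∈A ab x∈A y∉A xy
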